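{- Let $u$ be an indeterminate. For $k\ge1$ let $a_k=u^{\tau_2(k-1)}\in\mathbb{Z}[u]$; these are the coefficients of $t^{ -k}$ in $g_u(t)=t^{ -1}\prod_{i\ge0}(1+u\,t^{ -2^i})$. Let $H(1,n)=(a_{1+i+j})_{0\le i,j\le n}$. Then for every $n\ge1$ the polynomial $\det H(1,n)\in\mathbb{Z}[u]$ has degree $$2\sigma(n),\qquad\text{where }\sigma(n)=\sum_{i=1}^{n}\tau_2(i).$$
   Context: $\tau_2(m)$ denotes the number of $1$'s in the binary expansion of the nonnegative integer $m$. -}

module Defs where

open import Data.Nat using (ℕ; zero; suc; _+_; _∸_; _<_; _%_; _/_)
open import Data.Integer as ℤ using (ℤ; 0ℤ; 1ℤ)
open import Data.List using (List; []; _∷_; map; replicate; _++_)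
open import Data.Fin using (Fin; zero; suc; toℕ; punchIn)
open import Data.Product using (_×_)
open import Relation.Binary.PropositionalEquality using (_≡_; _≢_)

-- Binary digit sum τ₂(m): number of 1's in the binary expansion of m.
-- `bits f n` reads off f binary digits of n; f = n digits always suffice.

bits : ℕ → ℕ → ℕ
bits zero    _ = 0
bits (suc f) n = n % 2 + bits f (n / 2)

τ₂ : ℕ → ℕ
τ₂ n = bits n n

σ : ℕ → ℕ
σ zero    = 0
σ (suc n) = σ n + τ₂ (suc n)

-- Polynomials in ℤ[u], as little-endian coefficient lists
-- (trailing zeros allowed; equality of polynomials is via `coeff`).

Poly : Set
Poly = List ℤ

coeff : Poly → ℕ → ℤ
coeff []      _       = 0ℤ
coeff (a ∷ p) zero    = a
coeff (a ∷ p) (suc k) = coeff p k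

_+P_ : Poly → Poly → Poly
[]      +P q       = q
(a ∷ p) +P []      = a ∷ p
(a ∷ p) +P (b ∷ q) = (a ℤ.+ b) ∷ (p +P q)

negP : Poly → Poly
negP = map (λ x → ℤ.- x)

_*P_ : Poly → Poly → Poly
[]      *P q = []
(a ∷ p) *P q = map (a ℤ.*_) q +P (0ℤ ∷ (p *P q))

oneP : Poly
oneP = 1ℤ ∷ []

uPow : ℕ → Poly
uPow k = replicate k 0ℤ ++ (1ℤ ∷ [])

HasDegree : Poly → ℕ → Set
HasDegree p d = (coeff p d ≢ 0ℤ) × (∀ m → d < m → coeff p m ≡ 0ℤ)

sumP : ∀ n → (Fin n → Poly) → Poly
sumP zero    f = []
sumP (suc n) f = f zero +P sumP n (λ j → f (suc j))

signP : ℕ → Poly → Poly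
signP zero    p = p
signP (suc k) p = negP (signP k p)

det : ∀ n → (Fin n → Fin n → Poly) → Poly
det zero    M = oneP
det (suc n) M =
  sumP (suc n) (λ j → signP (toℕ j)
    (M zero j *P det n (λ r c → M (suc r) (punchIn j c))))

a : ℕ → Poly
a k = uPow (τ₂ (k ∸ 1))

H1 : (n : ℕ) → Fin (suc n) → Fin (suc n) → Poly
H1 n i j = a (1 + toℕ i + toℕ j)

-- The entries are u^E(r,c) with E(r,c) = τ₂(r + c) ≤ τ₂ r + τ₂ c, so every term of the Laplace
-- expansion has degree at most Σ τ₂ r + Σ τ₂ c = 2σ(n), and the coefficient of u^{2σ(n)} is the
-- determinant of the 0/1 matrix T(r,c) = [τ₂(r + c) = τ₂ r + τ₂ c] of carry-free pairs.
-- T(2x+a, 2y+b) = T(x,y) except that it vanishes when a = b = 1.  By this recursion every column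
-- of T can be cleared above the diagonal by adding a combination of earlier columns, leaving ±1
-- on the diagonal; hence det T = ±1 and the coefficient of u^{2σ(n)} is nonzero.
{-# OPTIONS --safe #-}
module Submission where

open import Defs
open import Data.Nat
open import Data.Nat.Properties
open import Data.Nat.DivMod
open import Data.Nat.Induction using (<-rec)
open import Data.Nat.Tactic.RingSolver using (solve-∀)
open import Data.Integer as ℤ using (ℤ; 0ℤ; 1ℤ; -1ℤ)
import Data.Integer.Properties as ℤP
import Data.Integer.Tactic.RingSolver as ℤ-Solver
open import Data.Bool using (if_then_else_)
open import Data.Fin as Fin using (Fin; toℕ; punchIn)
open import Data.Fin.Properties using (toℕ<n)
open import Data.List using (List; []; _∷_; map)
open import Data.List.Relation.Unary.All as All using (All; []; _∷_)
open import Data.List.Relation.Unary.All.Properties using (map⁺)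
open import Data.Product using (_×_; _,_; proj₂)
open import Data.Sum using (_⊎_; inj₁; inj₂)
open import Function using (_∘_)
open import Relation.Nullary using (does; yes; no; contradiction)
open import Relation.Nullary.Decidable using (dec-true; dec-false)
open import Relation.Binary using (tri<; tri≈; tri>)
open import Relation.Binary.PropositionalEquality

bits-0 : ∀ f → bits f 0 ≡ 0
bits-0 zero    = refl
bits-0 (suc f) = bits-0 f

bits-fuel : ∀ {f g n} → n ≤ f → n ≤ g → bits f n ≡ bits g n
bits-fuel {f} {g} {zero} _ _ = trans (bits-0 f) (sym (bits-0 g))
bits-fuel {suc f} {suc g} {n@(suc n-1)} (s≤s n≤f) (s≤s n≤g) =
  cong (n % 2 +_) (bits-fuel (≤-trans half≤ n≤f) (≤-trans half≤ n≤g))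
  where
  half≤ : n / 2 ≤ n-1
  half≤ = <⇒≤pred (m/n<m n 2 (s≤s (s≤s z≤n)))

τ₂-unfold : ∀ n → τ₂ n ≡ n % 2 + τ₂ (n / 2)
τ₂-unfold n = begin
  bits n n                   ≡⟨ bits-fuel ≤-refl (n≤1+n n) ⟩
  n % 2 + bits n (n / 2)     ≡⟨ cong (n % 2 +_) (bits-fuel (m/n≤m n 2) ≤-refl) ⟩
  n % 2 + τ₂ (n / 2)         ∎
  where open ≡-Reasoning

τ₂-even : ∀ m → τ₂ (m * 2) ≡ τ₂ m
τ₂-even m = begin
  τ₂ (m * 2)                          ≡⟨ τ₂-unfold (m * 2) ⟩
  (m * 2) % 2 + τ₂ (m * 2 / 2)        ≡⟨ cong₂ _+_ (m*n%n≡0 m 2) (cong τ₂ (m*n/n≡m m 2)) ⟩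
  τ₂ m                                ∎
  where open ≡-Reasoning

τ₂-odd : ∀ m → τ₂ (suc (m * 2)) ≡ suc (τ₂ m)
τ₂-odd m = begin
  τ₂ (1 + m * 2)                      ≡⟨ τ₂-unfold (1 + m * 2) ⟩
  (1 + m * 2) % 2 + τ₂ ((1 + m * 2) / 2)
    ≡⟨ cong₂ _+_ ([m+kn]%n≡m%n 1 m 2) (cong τ₂ (+-distrib-/-1+m*2)) ⟩
  1 + τ₂ m                            ∎
  where
  open ≡-Reasoning
  +-distrib-/-1+m*2 : (1 + m * 2) / 2 ≡ m
  +-distrib-/-1+m*2 = trans (+-distrib-/ 1 (m * 2) (subst (λ r → 1 + r < 2) (sym (m*n%n≡0 m 2)) ≤-refl))
                            (m*n/n≡m m 2)

data Halving : ℕ → Set where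
  even : ∀ m → Halving (m * 2)
  odd  : ∀ m → Halving (suc (m * 2))

halving : ∀ n → Halving n
halving zero = even 0
halving (suc n) with halving n
... | even m = odd m
... | odd m  = even (suc m)

binary-ind : (P : ℕ → Set) → P 0 → (∀ m → P (suc m) → P (suc m * 2)) →
             (∀ m → P m → P (suc (m * 2))) → ∀ n → P n
binary-ind P p₀ p-even p-odd = <-rec P step
  where
  step : ∀ n → (∀ {m} → m < n → P m) → P n
  step n rec with halving n
  ... | even zero    = p₀
  ... | even (suc m) = p-even m (rec (m<m*n (suc m) 2 (s≤s (s≤s z≤n))))
  ... | odd m        = p-odd m (rec (s≤s (m≤m*n m 2)))

τ₂-suc-≤ : ∀ n → τ₂ (suc n) ≤ suc (τ₂ n)
τ₂-suc-≤ = binary-ind _ ≤-refl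
  (λ m _ → ≤-reflexive (trans (τ₂-odd (suc m)) (cong suc (sym (τ₂-even (suc m))))))
  (λ m ih → begin
    τ₂ (suc m * 2)          ≡⟨ τ₂-even (suc m) ⟩
    τ₂ (suc m)              ≤⟨ ih ⟩
    suc (τ₂ m)              ≤⟨ n≤1+n _ ⟩
    suc (suc (τ₂ m))        ≡⟨ cong suc (sym (τ₂-odd m)) ⟩
    suc (τ₂ (suc (m * 2)))  ∎)
  where open ≤-Reasoning

τ₂-even+even : ∀ x y → τ₂ (x * 2 + y * 2) ≡ τ₂ (x + y)
τ₂-even+even x y = trans (cong τ₂ (sum x y)) (τ₂-even (x + y))
  where
  sum : ∀ x y → x * 2 + y * 2 ≡ (x + y) * 2
  sum = solve-∀

τ₂-even+odd : ∀ x y → τ₂ (x * 2 + suc (y * 2)) ≡ suc (τ₂ (x + y))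
τ₂-even+odd x y = trans (cong τ₂ (sum x y)) (τ₂-odd (x + y))
  where
  sum : ∀ x y → x * 2 + suc (y * 2) ≡ suc ((x + y) * 2)
  sum = solve-∀

τ₂-odd+even : ∀ x y → τ₂ (suc (x * 2) + y * 2) ≡ suc (τ₂ (x + y))
τ₂-odd+even x y = trans (cong τ₂ (sum x y)) (τ₂-odd (x + y))
  where
  sum : ∀ x y → suc (x * 2) + y * 2 ≡ suc ((x + y) * 2)
  sum = solve-∀

τ₂-odd+odd : ∀ x y → τ₂ (suc (x * 2) + suc (y * 2)) ≡ τ₂ (suc (x + y))
τ₂-odd+odd x y = trans (cong τ₂ (sum x y)) (τ₂-even (suc (x + y)))
  where
  sum : ∀ x y → suc (x * 2) + suc (y * 2) ≡ suc (x + y) * 2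
  sum = solve-∀

τ₂-odd+odd-< : ∀ x y → τ₂ (x + y) ≤ τ₂ x + τ₂ y →
               τ₂ (suc (x * 2) + suc (y * 2)) < τ₂ (suc (x * 2)) + τ₂ (suc (y * 2))
τ₂-odd+odd-< x y τ₂[x+y]≤ = begin-strict
  τ₂ (suc (x * 2) + suc (y * 2))        ≡⟨ τ₂-odd+odd x y ⟩
  τ₂ (suc (x + y))                      ≤⟨ τ₂-suc-≤ (x + y) ⟩
  suc (τ₂ (x + y))                      ≤⟨ s≤s τ₂[x+y]≤ ⟩
  suc (τ₂ x + τ₂ y)                     <⟨ n<1+n _ ⟩
  suc (suc (τ₂ x + τ₂ y))               ≡⟨ cong suc (sym (+-suc (τ₂ x) (τ₂ y))) ⟩
  suc (τ₂ x + suc (τ₂ y))               ≡⟨ sym (cong₂ _+_ (τ₂-odd x) (τ₂-odd y)) ⟩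
  τ₂ (suc (x * 2)) + τ₂ (suc (y * 2))   ∎
  where open ≤-Reasoning

τ₂-subadditive : ∀ a b → τ₂ (a + b) ≤ τ₂ a + τ₂ b
τ₂-subadditive = binary-ind _ (λ _ → ≤-refl) (λ m → even-case (suc m)) odd-case
  where
  open ≤-Reasoning
  even-case : ∀ x → (∀ b → τ₂ (x + b) ≤ τ₂ x + τ₂ b) → ∀ b → τ₂ (x * 2 + b) ≤ τ₂ (x * 2) + τ₂ b
  even-case x ih b with halving b
  ... | even y = begin
    τ₂ (x * 2 + y * 2)               ≡⟨ τ₂-even+even x y ⟩
    τ₂ (x + y)                       ≤⟨ ih y ⟩
    τ₂ x + τ₂ y                      ≡⟨ sym (cong₂ _+_ (τ₂-even x) (τ₂-even y)) ⟩
    τ₂ (x * 2) + τ₂ (y * 2)          ∎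
  ... | odd y = begin
    τ₂ (x * 2 + suc (y * 2))         ≡⟨ τ₂-even+odd x y ⟩
    suc (τ₂ (x + y))                 ≤⟨ s≤s (ih y) ⟩
    suc (τ₂ x + τ₂ y)                ≡⟨ sym (+-suc (τ₂ x) (τ₂ y)) ⟩
    τ₂ x + suc (τ₂ y)                ≡⟨ sym (cong₂ _+_ (τ₂-even x) (τ₂-odd y)) ⟩
    τ₂ (x * 2) + τ₂ (suc (y * 2))    ∎
  odd-case : ∀ x → (∀ b → τ₂ (x + b) ≤ τ₂ x + τ₂ b) →
             ∀ b → τ₂ (suc (x * 2) + b) ≤ τ₂ (suc (x * 2)) + τ₂ b
  odd-case x ih b with halving b
  ... | even y = begin
    τ₂ (suc (x * 2) + y * 2)         ≡⟨ τ₂-odd+even x y ⟩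
    suc (τ₂ (x + y))                 ≤⟨ s≤s (ih y) ⟩
    suc (τ₂ x + τ₂ y)                ≡⟨ sym (cong₂ _+_ (τ₂-odd x) (τ₂-even y)) ⟩
    τ₂ (suc (x * 2)) + τ₂ (y * 2)    ∎
  ... | odd y = <⇒≤ (τ₂-odd+odd-< x y (ih y))

δ : ℕ → ℕ → ℤ
δ zero    zero    = 1ℤ
δ zero    (suc n) = 0ℤ
δ (suc m) zero    = 0ℤ
δ (suc m) (suc n) = δ m n

δ-≡ : ∀ {m n} → m ≡ n → δ m n ≡ 1ℤ
δ-≡ {zero}  refl = refl
δ-≡ {suc m} refl = δ-≡ {m} refl

δ-≢ : ∀ {m n} → m ≢ n → δ m n ≡ 0ℤ
δ-≢ {zero}  {zero}  m≢n = contradiction refl m≢n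
δ-≢ {zero}  {suc n} m≢n = refl
δ-≢ {suc m} {zero}  m≢n = refl
δ-≢ {suc m} {suc n} m≢n = δ-≢ (m≢n ∘ cong suc)

Matrix : Set
Matrix = ℕ → ℕ → ℤ

IsUnit : ℤ → Set
IsUnit z = z ≡ 1ℤ ⊎ z ≡ -1ℤ

IsUnit-* : ∀ {y z} → IsUnit y → IsUnit z → IsUnit (y ℤ.* z)
IsUnit-* (inj₁ refl) (inj₁ refl) = inj₁ refl
IsUnit-* (inj₁ refl) (inj₂ refl) = inj₂ refl
IsUnit-* (inj₂ refl) (inj₁ refl) = inj₂ refl
IsUnit-* (inj₂ refl) (inj₂ refl) = inj₁ refl

Combination : Set
Combination = List (ℤ × ℕ)

combine : Combination → (ℕ → ℤ) → ℤ
combine []            v = 0ℤ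
combine ((c , k) ∷ L) v = c ℤ.* v k ℤ.+ combine L v

combine-cong : ∀ L {v w} → (∀ k → v k ≡ w k) → combine L v ≡ combine L w
combine-cong []            v≗w = refl
combine-cong ((c , k) ∷ L) v≗w = cong₂ (λ x y → c ℤ.* x ℤ.+ y) (v≗w k) (combine-cong L v≗w)

combine-scale : ∀ L a v → combine L (λ k → a ℤ.* v k) ≡ a ℤ.* combine L v
combine-scale []            a v = sym (ℤP.*-zeroʳ a)
combine-scale ((c , k) ∷ L) a v = trans (cong (ℤ._+_ (c ℤ.* (a ℤ.* v k))) (combine-scale L a v))
                                        (distribute c a (v k) (combine L v))
  where
  distribute : ∀ c a x y → c ℤ.* (a ℤ.* x) ℤ.+ a ℤ.* y ≡ a ℤ.* (c ℤ.* x ℤ.+ y)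
  distribute = ℤ-Solver.solve-∀

mapColumns : (ℕ → ℕ) → Combination → Combination
mapColumns h = map (λ (c , k) → c , h k)

combine-mapColumns : ∀ h L v → combine (mapColumns h L) v ≡ combine L (v ∘ h)
combine-mapColumns h []            v = refl
combine-mapColumns h ((c , k) ∷ L) v = cong (ℤ._+_ (c ℤ.* v (h k))) (combine-mapColumns h L v)

oddMinusEven : Combination → Combination
oddMinusEven []            = []
oddMinusEven ((c , k) ∷ L) = (c , suc (k * 2)) ∷ (ℤ.- c , k * 2) ∷ oddMinusEven L

combine-oddMinusEven : ∀ L v →
  combine (oddMinusEven L) v ≡ combine L (λ k → v (suc (k * 2)) ℤ.- v (k * 2))
combine-oddMinusEven []            v = refl
combine-oddMinusEven ((c , k) ∷ L) v =
  trans (cong (λ r → c ℤ.* v (suc (k * 2)) ℤ.+ (ℤ.- c ℤ.* v (k * 2) ℤ.+ r)) (combine-oddMinusEven L v))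
        (regroup c (v (suc (k * 2))) (v (k * 2)) _)
  where
  regroup : ∀ c x y r → c ℤ.* x ℤ.+ (ℤ.- c ℤ.* y ℤ.+ r) ≡ c ℤ.* (x ℤ.- y) ℤ.+ r
  regroup = ℤ-Solver.solve-∀

combine-cong-earlier : ∀ {j} L {v w} → All ((_< j) ∘ proj₂) L → (∀ k → k < j → v k ≡ w k) →
                       combine L v ≡ combine L w
combine-cong-earlier []            []           v≗w = refl
combine-cong-earlier ((c , k) ∷ L) (k<j ∷ L<j) v≗w =
  cong₂ (λ x y → c ℤ.* x ℤ.+ y) (v≗w k k<j) (combine-cong-earlier L L<j v≗w)

punchInℕ : ℕ → ℕ → ℕ
punchInℕ zero    c       = suc c
punchInℕ (suc j) zero    = zero
punchInℕ (suc j) (suc c) = suc (punchInℕ j c)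

punchOutℕ : ℕ → ℕ → ℕ
punchOutℕ zero    zero    = zero
punchOutℕ zero    (suc c) = c
punchOutℕ (suc j) zero    = zero
punchOutℕ (suc j) (suc c) = suc (punchOutℕ j c)

punchInℕ-≢ : ∀ j k → punchInℕ j k ≢ j
punchInℕ-≢ (suc j) (suc k) e = punchInℕ-≢ j k (suc-injective e)

punchInℕ-punchOutℕ : ∀ {j c} → j ≢ c → punchInℕ j (punchOutℕ j c) ≡ c
punchInℕ-punchOutℕ {zero}  {zero}  j≢c = contradiction refl j≢c
punchInℕ-punchOutℕ {zero}  {suc c} j≢c = refl
punchInℕ-punchOutℕ {suc j} {zero}  j≢c = refl
punchInℕ-punchOutℕ {suc j} {suc c} j≢c = cong suc (punchInℕ-punchOutℕ (j≢c ∘ cong suc))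

punchInℕ-injective : ∀ j {k l} → punchInℕ j k ≡ punchInℕ j l → k ≡ l
punchInℕ-injective zero    e = suc-injective e
punchInℕ-injective (suc j) {zero}  {zero}  e = refl
punchInℕ-injective (suc j) {suc k} {suc l} e = cong suc (punchInℕ-injective j (suc-injective e))

punchInℕ≡⇒≡punchOutℕ : ∀ {j c k} → j ≢ c → punchInℕ j k ≡ c → k ≡ punchOutℕ j c
punchInℕ≡⇒≡punchOutℕ {j} j≢c e = punchInℕ-injective j (trans e (sym (punchInℕ-punchOutℕ j≢c)))

punchOutℕ-< : ∀ {n j c} → c < suc n → j < suc n → j ≢ c → punchOutℕ j c < n
punchOutℕ-< {_}     {zero}  {zero}  _         _         j≢c = contradiction refl j≢c
punchOutℕ-< {_}     {zero}  {suc c} (s≤s c<n) _         _   = c<n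
punchOutℕ-< {suc n} {suc j} {zero}  _         _         _   = s≤s z≤n
punchOutℕ-< {suc n} {suc j} {suc c} (s≤s c<n) (s≤s j<n) j≢c =
  s≤s (punchOutℕ-< c<n j<n (j≢c ∘ cong suc))
punchOutℕ-< {zero}  {suc j} _         (s≤s ()) _

punchInℕ-< : ∀ {n} j {k} → k < n → punchInℕ j k < suc n
punchInℕ-< j k<n = s≤s (≤-trans (punchInℕ-≤ j _) k<n)
  where
  punchInℕ-≤ : ∀ j k → punchInℕ j k ≤ suc k
  punchInℕ-≤ zero    k       = ≤-refl
  punchInℕ-≤ (suc j) zero    = z≤n
  punchInℕ-≤ (suc j) (suc k) = s≤s (punchInℕ-≤ j k)

punchOutℕ-suc : ∀ {j c} → j ≢ c → j ≢ suc c → punchOutℕ j (suc c) ≡ suc (punchOutℕ j c)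
punchOutℕ-suc {zero}        {zero}  j≢c _     = contradiction refl j≢c
punchOutℕ-suc {zero}        {suc c} _   _     = refl
punchOutℕ-suc {suc zero}    {zero}  _   j≢1+c = contradiction refl j≢1+c
punchOutℕ-suc {suc (suc j)} {zero}  _   _     = refl
punchOutℕ-suc {suc j}       {suc c} j≢c j≢1+c =
  cong suc (punchOutℕ-suc (j≢c ∘ cong suc) (j≢1+c ∘ cong suc))

punchInℕ-self : ∀ c → punchInℕ c c ≡ suc c
punchInℕ-self zero    = refl
punchInℕ-self (suc c) = cong suc (punchInℕ-self c)

punchInℕ-suc-self : ∀ c → punchInℕ (suc c) c ≡ c
punchInℕ-suc-self zero    = refl
punchInℕ-suc-self (suc c) = cong suc (punchInℕ-suc-self c)

punchInℕ-suc : ∀ {c k} → k ≢ c → punchInℕ c k ≡ punchInℕ (suc c) k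
punchInℕ-suc {zero}  {zero}  k≢c = contradiction refl k≢c
punchInℕ-suc {zero}  {suc k} _   = refl
punchInℕ-suc {suc c} {zero}  _   = refl
punchInℕ-suc {suc c} {suc k} k≢c = cong suc (punchInℕ-suc (k≢c ∘ cong suc))

sumℤ : ℕ → (ℕ → ℤ) → ℤ
sumℤ zero    h = 0ℤ
sumℤ (suc n) h = h 0 ℤ.+ sumℤ n (h ∘ suc)

sumℤ-cong : ∀ n {h h′} → (∀ j → j < n → h j ≡ h′ j) → sumℤ n h ≡ sumℤ n h′
sumℤ-cong zero    h≗h′ = refl
sumℤ-cong (suc n) h≗h′ = cong₂ ℤ._+_ (h≗h′ 0 z<s) (sumℤ-cong n (λ j j<n → h≗h′ (suc j) (s≤s j<n)))

sumℤ-zero : ∀ n {h} → (∀ j → j < n → h j ≡ 0ℤ) → sumℤ n h ≡ 0ℤ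
sumℤ-zero zero    h≗0 = refl
sumℤ-zero (suc n) h≗0 = cong₂ ℤ._+_ (h≗0 0 z<s) (sumℤ-zero n (λ j j<n → h≗0 (suc j) (s≤s j<n)))

sumℤ-linear : ∀ n x y h h′ →
  sumℤ n (λ j → x ℤ.* h j ℤ.+ y ℤ.* h′ j) ≡ x ℤ.* sumℤ n h ℤ.+ y ℤ.* sumℤ n h′
sumℤ-linear zero    x y h h′ = distrib-0 x y
  where
  distrib-0 : ∀ x y → 0ℤ ≡ x ℤ.* 0ℤ ℤ.+ y ℤ.* 0ℤ
  distrib-0 = ℤ-Solver.solve-∀
sumℤ-linear (suc n) x y h h′ =
  trans (cong (ℤ._+_ (x ℤ.* h 0 ℤ.+ y ℤ.* h′ 0)) (sumℤ-linear n x y (h ∘ suc) (h′ ∘ suc)))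
        (distrib x y (h 0) (h′ 0) (sumℤ n (h ∘ suc)) (sumℤ n (h′ ∘ suc)))
  where
  distrib : ∀ x y a b c d → x ℤ.* a ℤ.+ y ℤ.* b ℤ.+ (x ℤ.* c ℤ.+ y ℤ.* d) ≡ x ℤ.* (a ℤ.+ c) ℤ.+ y ℤ.* (b ℤ.+ d)
  distrib = ℤ-Solver.solve-∀

sumℤ-cancel-adjacent : ∀ n c {h} → suc c < n → (∀ j → j < n → j ≢ c → j ≢ suc c → h j ≡ 0ℤ) →
                       h c ℤ.+ h (suc c) ≡ 0ℤ → sumℤ n h ≡ 0ℤ
sumℤ-cancel-adjacent (suc (suc n)) zero {h} _ others≡0 pair≡0 = begin
  h 0 ℤ.+ (h 1 ℤ.+ sumℤ n (h ∘ suc ∘ suc))   ≡⟨ ℤP.+-assoc (h 0) (h 1) _ ⟨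
  h 0 ℤ.+ h 1 ℤ.+ sumℤ n (h ∘ suc ∘ suc)     ≡⟨ cong₂ ℤ._+_ pair≡0 rest≡0 ⟩
  0ℤ                                         ∎
  where
  open ≡-Reasoning
  rest≡0 : sumℤ n (h ∘ suc ∘ suc) ≡ 0ℤ
  rest≡0 = sumℤ-zero n (λ j j<n → others≡0 (2 + j) (s≤s (s≤s j<n)) (λ ()) (λ ()))
sumℤ-cancel-adjacent (suc n) (suc c) {h} (s≤s 1+c<n) others≡0 pair≡0 =
  cong₂ ℤ._+_ (others≡0 0 z<s (λ ()) (λ ()))
    (sumℤ-cancel-adjacent n c 1+c<n
      (λ j j<n j≢c j≢1+c → others≡0 (suc j) (s≤s j<n) (j≢c ∘ suc-injective) (j≢1+c ∘ suc-injective))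
      pair≡0)

minor : Matrix → ℕ → Matrix
minor M j r c = M (suc r) (punchInℕ j c)

detℤ : ℕ → Matrix → ℤ
detℤ zero    M = 1ℤ
detℤ (suc n) M = sumℤ (suc n) (λ j → -1ℤ ℤ.^ j ℤ.* (M 0 j ℤ.* detℤ n (minor M j)))

detℤ-cong : ∀ n {M N} → (∀ r k → k < n → M r k ≡ N r k) → detℤ n M ≡ detℤ n N
detℤ-cong zero    M≗N = refl
detℤ-cong (suc n) M≗N = sumℤ-cong (suc n) λ j j<n →
  cong₂ (λ x y → -1ℤ ℤ.^ j ℤ.* (x ℤ.* y)) (M≗N 0 j j<n)
        (detℤ-cong n (λ r k k<n → M≗N (suc r) (punchInℕ j k) (punchInℕ-< j k<n)))

detℤ-linear : ∀ n {c} x y (M N P : Matrix) → c < n →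
  (∀ r k → k ≢ c → P r k ≡ M r k) → (∀ r k → k ≢ c → N r k ≡ M r k) →
  (∀ r → P r c ≡ x ℤ.* M r c ℤ.+ y ℤ.* N r c) →
  detℤ n P ≡ x ℤ.* detℤ n M ℤ.+ y ℤ.* detℤ n N
detℤ-linear (suc n) {c} x y M N P c<n P≗M N≗M Pc≡ =
  trans (sumℤ-cong (suc n) term) (sumℤ-linear (suc n) x y (expansion M) (expansion N))
  where
  expansion : Matrix → ℕ → ℤ
  expansion A j = -1ℤ ℤ.^ j ℤ.* (A 0 j ℤ.* detℤ n (minor A j))
  term : ∀ j → j < suc n → expansion P j ≡ x ℤ.* expansion M j ℤ.+ y ℤ.* expansion N j
  term j j<n with j ≟ c
  ... | yes refl = begin
    s ℤ.* (P 0 j ℤ.* detℤ n (minor P j))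
      ≡⟨ cong₂ (λ a d → s ℤ.* (a ℤ.* d)) (Pc≡ 0) (detℤ-cong n (λ r k _ → P≗M (suc r) _ (punchInℕ-≢ j k))) ⟩
    s ℤ.* ((x ℤ.* M 0 j ℤ.+ y ℤ.* N 0 j) ℤ.* detℤ n (minor M j))
      ≡⟨ distrib s (M 0 j) (N 0 j) (detℤ n (minor M j)) x y ⟩
    x ℤ.* expansion M j ℤ.+ y ℤ.* (s ℤ.* (N 0 j ℤ.* detℤ n (minor M j)))
      ≡⟨ cong (λ d → x ℤ.* expansion M j ℤ.+ y ℤ.* (s ℤ.* (N 0 j ℤ.* d)))
              (detℤ-cong n (λ r k _ → sym (N≗M (suc r) _ (punchInℕ-≢ j k)))) ⟩
    x ℤ.* expansion M j ℤ.+ y ℤ.* expansion N j ∎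
    where
    open ≡-Reasoning
    s = -1ℤ ℤ.^ j
    distrib : ∀ s a b d x y → s ℤ.* ((x ℤ.* a ℤ.+ y ℤ.* b) ℤ.* d) ≡ x ℤ.* (s ℤ.* (a ℤ.* d)) ℤ.+ y ℤ.* (s ℤ.* (b ℤ.* d))
    distrib = ℤ-Solver.solve-∀
  ... | no j≢c = begin
    s ℤ.* (P 0 j ℤ.* detℤ n (minor P j))
      ≡⟨ cong₂ (λ a d → s ℤ.* (a ℤ.* d)) (P≗M 0 j j≢c) minor-linear ⟩
    s ℤ.* (M 0 j ℤ.* (x ℤ.* detℤ n (minor M j) ℤ.+ y ℤ.* detℤ n (minor N j)))
      ≡⟨ distrib s (M 0 j) (detℤ n (minor M j)) (detℤ n (minor N j)) x y ⟩
    x ℤ.* expansion M j ℤ.+ y ℤ.* (s ℤ.* (M 0 j ℤ.* detℤ n (minor N j)))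
      ≡⟨ cong (λ a → x ℤ.* expansion M j ℤ.+ y ℤ.* (s ℤ.* (a ℤ.* detℤ n (minor N j)))) (sym (N≗M 0 j j≢c)) ⟩
    x ℤ.* expansion M j ℤ.+ y ℤ.* expansion N j ∎
    where
    open ≡-Reasoning
    s = -1ℤ ℤ.^ j
    distrib : ∀ s a d e x y → s ℤ.* (a ℤ.* (x ℤ.* d ℤ.+ y ℤ.* e)) ≡ x ℤ.* (s ℤ.* (a ℤ.* d)) ℤ.+ y ℤ.* (s ℤ.* (a ℤ.* e))
    distrib = ℤ-Solver.solve-∀
    away : ∀ {k} → k ≢ punchOutℕ j c → punchInℕ j k ≢ c
    away k≢ e = k≢ (punchInℕ≡⇒≡punchOutℕ j≢c e)
    minor-linear : detℤ n (minor P j) ≡ x ℤ.* detℤ n (minor M j) ℤ.+ y ℤ.* detℤ n (minor N j)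
    minor-linear = detℤ-linear n x y (minor M j) (minor N j) (minor P j) (punchOutℕ-< c<n j<n j≢c)
      (λ r k k≢ → P≗M (suc r) (punchInℕ j k) (away k≢))
      (λ r k k≢ → N≗M (suc r) (punchInℕ j k) (away k≢))
      (λ r → subst (λ l → P (suc r) l ≡ x ℤ.* M (suc r) l ℤ.+ y ℤ.* N (suc r) l)
                   (sym (punchInℕ-punchOutℕ j≢c)) (Pc≡ (suc r)))

detℤ-adjacent-equal : ∀ n {c} (M : Matrix) → suc c < n → (∀ r → M r c ≡ M r (suc c)) → detℤ n M ≡ 0ℤ
detℤ-adjacent-equal (suc n) {c} M 1+c<n Mc≗Mc+1 = sumℤ-cancel-adjacent (suc n) c 1+c<n others pair
  where
  expansion : ℕ → ℤ
  expansion j = -1ℤ ℤ.^ j ℤ.* (M 0 j ℤ.* detℤ n (minor M j))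
  others : ∀ j → j < suc n → j ≢ c → j ≢ suc c → expansion j ≡ 0ℤ
  others j j<n j≢c j≢1+c = begin
    expansion j                        ≡⟨ cong (λ d → -1ℤ ℤ.^ j ℤ.* (M 0 j ℤ.* d)) minor≡0 ⟩
    -1ℤ ℤ.^ j ℤ.* (M 0 j ℤ.* 0ℤ)       ≡⟨ cong (-1ℤ ℤ.^ j ℤ.*_) (ℤP.*-zeroʳ (M 0 j)) ⟩
    -1ℤ ℤ.^ j ℤ.* 0ℤ                   ≡⟨ ℤP.*-zeroʳ (-1ℤ ℤ.^ j) ⟩
    0ℤ                                 ∎
    where
    open ≡-Reasoning
    c′ = punchOutℕ j c
    at-c′ : punchInℕ j c′ ≡ c
    at-c′ = punchInℕ-punchOutℕ j≢c
    at-1+c′ : punchInℕ j (suc c′) ≡ suc c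
    at-1+c′ = trans (cong (punchInℕ j) (sym (punchOutℕ-suc j≢c j≢1+c))) (punchInℕ-punchOutℕ j≢1+c)
    minor≡0 : detℤ n (minor M j) ≡ 0ℤ
    minor≡0 = detℤ-adjacent-equal n (minor M j)
      (subst (_< n) (punchOutℕ-suc j≢c j≢1+c) (punchOutℕ-< 1+c<n j<n j≢1+c))
      (λ r → trans (cong (M (suc r)) at-c′) (trans (Mc≗Mc+1 (suc r)) (cong (M (suc r)) (sym at-1+c′))))
  same-minor : ∀ r k → M (suc r) (punchInℕ (suc c) k) ≡ M (suc r) (punchInℕ c k)
  same-minor r k with k ≟ c
  ... | yes refl = trans (cong (M (suc r)) (punchInℕ-suc-self k))
                         (trans (Mc≗Mc+1 (suc r)) (cong (M (suc r)) (sym (punchInℕ-self k))))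
  ... | no k≢c   = cong (M (suc r)) (sym (punchInℕ-suc k≢c))
  pair : expansion c ℤ.+ expansion (suc c) ≡ 0ℤ
  pair = begin
    expansion c ℤ.+ -1ℤ ℤ.* -1ℤ ℤ.^ c ℤ.* (M 0 (suc c) ℤ.* detℤ n (minor M (suc c)))
      ≡⟨ cong₂ (λ a d → expansion c ℤ.+ -1ℤ ℤ.* -1ℤ ℤ.^ c ℤ.* (a ℤ.* d))
               (sym (Mc≗Mc+1 0)) (detℤ-cong n (λ r k _ → same-minor r k)) ⟩
    expansion c ℤ.+ -1ℤ ℤ.* -1ℤ ℤ.^ c ℤ.* (M 0 c ℤ.* detℤ n (minor M c))
      ≡⟨ cancel (-1ℤ ℤ.^ c) (M 0 c ℤ.* detℤ n (minor M c)) ⟩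
    0ℤ ∎
    where
    open ≡-Reasoning
    cancel : ∀ s a → s ℤ.* a ℤ.+ -1ℤ ℤ.* s ℤ.* a ≡ 0ℤ
    cancel = ℤ-Solver.solve-∀

updateColumn : Matrix → ℕ → (ℕ → ℤ) → Matrix
updateColumn M c v r k = if does (k ≟ c) then v r else M r k

updateColumn-≡ : ∀ M c v r → updateColumn M c v r c ≡ v r
updateColumn-≡ M c v r = cong (if_then v r else M r c) (dec-true (c ≟ c) refl)

updateColumn-≢ : ∀ M {c} v r {k} → k ≢ c → updateColumn M c v r k ≡ M r k
updateColumn-≢ M {c} v r {k} k≢c = cong (if_then v r else M r k) (dec-false (k ≟ c) k≢c)

updateColumns : Matrix → ℕ → (ℕ → ℤ) → (ℕ → ℤ) → Matrix
updateColumns M c f g = updateColumn (updateColumn M c f) (suc c) g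

module _ (M : Matrix) (c : ℕ) where

  private
    c≢1+c : c ≢ suc c
    c≢1+c = <⇒≢ (n<1+n c)

  updateColumns-fst : ∀ f g r → updateColumns M c f g r c ≡ f r
  updateColumns-fst f g r = trans (updateColumn-≢ (updateColumn M c f) g r c≢1+c) (updateColumn-≡ M c f r)

  updateColumns-snd : ∀ f g r → updateColumns M c f g r (suc c) ≡ g r
  updateColumns-snd f g r = updateColumn-≡ (updateColumn M c f) (suc c) g r

  updateColumns-other : ∀ f g r {k} → k ≢ c → k ≢ suc c → updateColumns M c f g r k ≡ M r k
  updateColumns-other f g r k≢c k≢1+c = trans (updateColumn-≢ (updateColumn M c f) g r k≢1+c) (updateColumn-≢ M f r k≢c)

  updateColumns-≢fst : ∀ f f′ g r k → k ≢ c → updateColumns M c f g r k ≡ updateColumns M c f′ g r k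
  updateColumns-≢fst f f′ g r k k≢c with k ≟ suc c
  ... | yes refl    = trans (updateColumns-snd f g r) (sym (updateColumns-snd f′ g r))
  ... | no k≢1+c   = trans (updateColumns-other f g r k≢c k≢1+c) (sym (updateColumns-other f′ g r k≢c k≢1+c))

  updateColumns-≢snd : ∀ f g g′ r k → k ≢ suc c → updateColumns M c f g r k ≡ updateColumns M c f g′ r k
  updateColumns-≢snd f g g′ r k k≢1+c with k ≟ c
  ... | yes refl = trans (updateColumns-fst f g r) (sym (updateColumns-fst f g′ r))
  ... | no k≢c   = trans (updateColumns-other f g r k≢c k≢1+c) (sym (updateColumns-other f g′ r k≢c k≢1+c))

  updateColumns-≗ : ∀ {f g} (N : Matrix) → (∀ r → N r c ≡ f r) → (∀ r → N r (suc c) ≡ g r) →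
    (∀ r k → k ≢ c → k ≢ suc c → N r k ≡ M r k) → ∀ r k → updateColumns M c f g r k ≡ N r k
  updateColumns-≗ {f} {g} N Nc Nc+1 N≗M r k with k ≟ c | k ≟ suc c
  ... | yes refl | _        = trans (updateColumns-fst f g r) (sym (Nc r))
  ... | no _     | yes refl = trans (updateColumns-snd f g r) (sym (Nc+1 r))
  ... | no k≢c   | no k≢1+c = trans (updateColumns-other f g r k≢c k≢1+c) (sym (N≗M r k k≢c k≢1+c))

detℤ-swap-adjacent : ∀ n {c} (M N : Matrix) → suc c < n →
  (∀ r → N r c ≡ M r (suc c)) → (∀ r → N r (suc c) ≡ M r c) →
  (∀ r k → k ≢ c → k ≢ suc c → N r k ≡ M r k) → detℤ n N ≡ ℤ.- detℤ n M
detℤ-swap-adjacent n {c} M N 1+c<n Nc Nc+1 N≗M = begin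
  detℤ n N                                ≡⟨ isolate (detℤ n M) (detℤ n N) ⟩
  ℤ.- detℤ n M ℤ.+ (detℤ n M ℤ.+ detℤ n N) ≡⟨ cong (ℤ._+_ (ℤ.- detℤ n M)) sum≡0 ⟩
  ℤ.- detℤ n M ℤ.+ 0ℤ                      ≡⟨ ℤP.+-identityʳ _ ⟩
  ℤ.- detℤ n M                            ∎
  where
  open ≡-Reasoning
  isolate : ∀ a b → b ≡ ℤ.- a ℤ.+ (a ℤ.+ b)
  isolate = ℤ-Solver.solve-∀
  pad : ∀ a b → a ℤ.+ b ≡ 0ℤ ℤ.+ a ℤ.+ (b ℤ.+ 0ℤ)
  pad = ℤ-Solver.solve-∀
  u v w : ℕ → ℤ
  u r = M r c
  v r = M r (suc c)
  w r = u r ℤ.+ v r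
  D : (ℕ → ℤ) → (ℕ → ℤ) → ℤ
  D f g = detℤ n (updateColumns M c f g)
  unit-coefficients : ∀ a b → 1ℤ ℤ.* a ℤ.+ 1ℤ ℤ.* b ≡ a ℤ.+ b
  unit-coefficients a b = cong₂ ℤ._+_ (ℤP.*-identityˡ a) (ℤP.*-identityˡ b)
  additive-fst : ∀ g → D w g ≡ D u g ℤ.+ D v g
  additive-fst g = trans
    (detℤ-linear n 1ℤ 1ℤ _ _ _ (<-trans (n<1+n c) 1+c<n)
      (λ r k k≢c → updateColumns-≢fst M c w u g r k k≢c)
      (λ r k k≢c → updateColumns-≢fst M c v u g r k k≢c)
      (λ r → trans (updateColumns-fst M c w g r) (sym (trans (cong₂ (λ a b → 1ℤ ℤ.* a ℤ.+ 1ℤ ℤ.* b)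
        (updateColumns-fst M c u g r) (updateColumns-fst M c v g r)) (unit-coefficients (u r) (v r))))))
    (unit-coefficients (D u g) (D v g))
  additive-snd : ∀ f → D f w ≡ D f u ℤ.+ D f v
  additive-snd f = trans
    (detℤ-linear n 1ℤ 1ℤ _ _ _ 1+c<n
      (λ r k k≢1+c → updateColumns-≢snd M c f w u r k k≢1+c)
      (λ r k k≢1+c → updateColumns-≢snd M c f v u r k k≢1+c)
      (λ r → trans (updateColumns-snd M c f w r) (sym (trans (cong₂ (λ a b → 1ℤ ℤ.* a ℤ.+ 1ℤ ℤ.* b)
        (updateColumns-snd M c f u r) (updateColumns-snd M c f v r)) (unit-coefficients (u r) (v r))))))
    (unit-coefficients (D f u) (D f v))
  diagonal≡0 : ∀ f → D f f ≡ 0ℤ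
  diagonal≡0 f = detℤ-adjacent-equal n _ 1+c<n
    (λ r → trans (updateColumns-fst M c f f r) (sym (updateColumns-snd M c f f r)))
  D[u,v]≡detM : D u v ≡ detℤ n M
  D[u,v]≡detM = detℤ-cong n λ r k _ → updateColumns-≗ M c M (λ _ → refl) (λ _ → refl) (λ _ _ _ _ → refl) r k
  D[v,u]≡detN : D v u ≡ detℤ n N
  D[v,u]≡detN = detℤ-cong n λ r k _ → updateColumns-≗ M c N Nc Nc+1 N≗M r k
  sum≡0 : detℤ n M ℤ.+ detℤ n N ≡ 0ℤ
  sum≡0 = begin
    detℤ n M ℤ.+ detℤ n N                        ≡⟨ cong₂ ℤ._+_ D[u,v]≡detM D[v,u]≡detN ⟨
    D u v ℤ.+ D v u                              ≡⟨ pad (D u v) (D v u) ⟩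
    0ℤ ℤ.+ D u v ℤ.+ (D v u ℤ.+ 0ℤ)              ≡⟨ cong₂ (λ a b → a ℤ.+ D u v ℤ.+ (D v u ℤ.+ b)) (diagonal≡0 u) (diagonal≡0 v) ⟨
    D u u ℤ.+ D u v ℤ.+ (D v u ℤ.+ D v v)        ≡⟨ cong₂ ℤ._+_ (additive-snd u) (additive-snd v) ⟨
    D u w ℤ.+ D v w                              ≡⟨ additive-fst w ⟨
    D w w                                        ≡⟨ diagonal≡0 w ⟩
    0ℤ                                           ∎

detℤ-equal-columns : ∀ n {c d} (M : Matrix) → c < d → d < n → (∀ r → M r c ≡ M r d) → detℤ n M ≡ 0ℤ
detℤ-equal-columns n {c} {suc d} M c<1+d 1+d<n Mc≗Md with m<1+n⇒m<n∨m≡n c<1+d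
... | inj₂ refl = detℤ-adjacent-equal n M 1+d<n Mc≗Md
... | inj₁ c<d  = begin
  detℤ n M          ≡⟨ ℤP.neg-involutive (detℤ n M) ⟨
  ℤ.- ℤ.- detℤ n M  ≡⟨ cong ℤ.-_ swapped ⟨
  ℤ.- detℤ n N      ≡⟨ cong ℤ.-_ N≡0 ⟩
  0ℤ                ∎
  where
  open ≡-Reasoning
  u v : ℕ → ℤ
  u r = M r d
  v r = M r (suc d)
  N : Matrix
  N = updateColumns M d v u
  swapped : detℤ n N ≡ ℤ.- detℤ n M
  swapped = detℤ-swap-adjacent n M N 1+d<n (updateColumns-fst M d v u) (updateColumns-snd M d v u)
    (λ r k → updateColumns-other M d v u r)
  N≡0 : detℤ n N ≡ 0ℤ
  N≡0 = detℤ-equal-columns n N c<d (<-trans (n<1+n d) 1+d<n) λ r → begin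
    N r c         ≡⟨ updateColumns-other M d v u r (<⇒≢ c<d) (<⇒≢ c<1+d) ⟩
    M r c         ≡⟨ Mc≗Md r ⟩
    M r (suc d)   ≡⟨ updateColumns-fst M d v u r ⟨
    N r d         ∎

detℤ-add-multiple : ∀ n {j k} a (M P : Matrix) → k < j → j < n →
  (∀ r l → l ≢ j → P r l ≡ M r l) → (∀ r → P r j ≡ M r j ℤ.+ a ℤ.* M r k) → detℤ n P ≡ detℤ n M
detℤ-add-multiple n {j} {k} a M P k<j j<n P≗M Pj≡ = begin
  detℤ n P                               ≡⟨ detℤ-linear n 1ℤ a M N P j<n P≗M (λ r l → updateColumn-≢ M v r) Pj≡′ ⟩
  1ℤ ℤ.* detℤ n M ℤ.+ a ℤ.* detℤ n N     ≡⟨ cong (λ d → 1ℤ ℤ.* detℤ n M ℤ.+ a ℤ.* d) N≡0 ⟩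
  1ℤ ℤ.* detℤ n M ℤ.+ a ℤ.* 0ℤ           ≡⟨ simplify (detℤ n M) a ⟩
  detℤ n M                               ∎
  where
  open ≡-Reasoning
  simplify : ∀ d a → 1ℤ ℤ.* d ℤ.+ a ℤ.* 0ℤ ≡ d
  simplify = ℤ-Solver.solve-∀
  v : ℕ → ℤ
  v r = M r k
  N : Matrix
  N = updateColumn M j v
  Pj≡′ : ∀ r → P r j ≡ 1ℤ ℤ.* M r j ℤ.+ a ℤ.* N r j
  Pj≡′ r = trans (Pj≡ r) (cong₂ ℤ._+_ (sym (ℤP.*-identityˡ (M r j))) (cong (a ℤ.*_) (sym (updateColumn-≡ M j v r))))
  N≡0 : detℤ n N ≡ 0ℤ
  N≡0 = detℤ-equal-columns n N k<j j<n
    (λ r → trans (updateColumn-≢ M v r (<⇒≢ k<j)) (sym (updateColumn-≡ M j v r)))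

detℤ-add-combination : ∀ n {j} (M P : Matrix) L → All ((_< j) ∘ proj₂) L → j < n →
  (∀ r l → l ≢ j → P r l ≡ M r l) → (∀ r → P r j ≡ M r j ℤ.+ combine L (M r)) → detℤ n P ≡ detℤ n M
detℤ-add-combination n {j} M P [] [] j<n P≗M Pj≡ = detℤ-cong n λ r l _ → P≗M′ r l
  where
  P≗M′ : ∀ r l → P r l ≡ M r l
  P≗M′ r l with l ≟ j
  ... | yes refl = trans (Pj≡ r) (ℤP.+-identityʳ (M r l))
  ... | no l≢j   = P≗M r l l≢j
detℤ-add-combination n {j} M P ((a , k) ∷ L) (k<j ∷ L<j) j<n P≗M Pj≡ =
  trans (detℤ-add-multiple n a P′ P k<j j<n
          (λ r l l≢j → trans (P≗M r l l≢j) (sym (updateColumn-≢ M v r l≢j)))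
          (λ r → trans (Pj≡ r) (trans (regroup (M r j) a (M r k) (combine L (M r)))
            (cong₂ (λ x y → x ℤ.+ a ℤ.* y) (sym (updateColumn-≡ M j v r)) (sym (updateColumn-≢ M v r (<⇒≢ k<j)))))))
        (detℤ-add-combination n M P′ L L<j j<n (λ r l → updateColumn-≢ M v r) (updateColumn-≡ M j v))
  where
  v : ℕ → ℤ
  v r = M r j ℤ.+ combine L (M r)
  P′ : Matrix
  P′ = updateColumn M j v
  regroup : ∀ x a y z → x ℤ.+ (a ℤ.* y ℤ.+ z) ≡ x ℤ.+ z ℤ.+ a ℤ.* y
  regroup = ℤ-Solver.solve-∀

detℤ-lowerTriangular : ∀ n (M : Matrix) → (∀ r j → r < j → M r j ≡ 0ℤ) → (∀ j → IsUnit (M j j)) →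
                       IsUnit (detℤ n M)
detℤ-lowerTriangular zero    M upper≡0 unit-diagonal = inj₁ refl
detℤ-lowerTriangular (suc n) M upper≡0 unit-diagonal =
  subst IsUnit (sym first-column) (IsUnit-* (unit-diagonal 0)
    (detℤ-lowerTriangular n (minor M 0) (λ r j r<j → upper≡0 (suc r) (suc j) (s≤s r<j)) (unit-diagonal ∘ suc)))
  where
  first-column : detℤ (suc n) M ≡ M 0 0 ℤ.* detℤ n (minor M 0)
  first-column = trans
    (cong₂ ℤ._+_ (ℤP.*-identityˡ (M 0 0 ℤ.* detℤ n (minor M 0))) (sumℤ-zero n λ j _ →
       trans (cong (λ a → -1ℤ ℤ.^ suc j ℤ.* (a ℤ.* detℤ n (minor M (suc j)))) (upper≡0 0 (suc j) z<s))
             (ℤP.*-zeroʳ (-1ℤ ℤ.^ suc j))))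
    (ℤP.+-identityʳ (M 0 0 ℤ.* detℤ n (minor M 0)))

reduced : Matrix → Combination → ℕ → ℕ → ℤ
reduced M L j i = M i j ℤ.+ combine L (M i)

reduced-scale : ∀ (M N : Matrix) L j r x a → (∀ k → N r k ≡ a ℤ.* M x k) →
                reduced N L j r ≡ a ℤ.* reduced M L j x
reduced-scale M N L j r x a N≗aM =
  trans (cong₂ ℤ._+_ (N≗aM j) (trans (combine-cong L N≗aM) (combine-scale L a (M x))))
        (sym (ℤP.*-distribˡ-+ a (M x j) (combine L (M x))))

reduced-oddMinusEven : ∀ (M : Matrix) L m r →
  reduced M ((-1ℤ , m * 2) ∷ oddMinusEven L) (suc (m * 2)) r ≡
  reduced (λ r k → M r (suc (k * 2)) ℤ.- M r (k * 2)) L m r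
reduced-oddMinusEven M L m r =
  trans (cong (λ y → M r (suc (m * 2)) ℤ.+ (-1ℤ ℤ.* M r (m * 2) ℤ.+ y)) (combine-oddMinusEven L (M r)))
        (regroup (M r (suc (m * 2))) (M r (m * 2)) _)
  where
  regroup : ∀ x y z → x ℤ.+ (-1ℤ ℤ.* y ℤ.+ z) ≡ x ℤ.- y ℤ.+ z
  regroup = ℤ-Solver.solve-∀

record ColumnReduction (M : Matrix) (j : ℕ) : Set where
  field
    combination : Combination
    earlier     : All ((_< j) ∘ proj₂) combination
    above-zero  : ∀ i → i < j → reduced M combination j i ≡ 0ℤ
    diagonal    : IsUnit (reduced M combination j j)

module _ {M : Matrix} (R : ∀ j → ColumnReduction M j) where

  open ColumnReduction

  reducedMatrix : Matrix
  reducedMatrix i j = reduced M (combination (R j)) j i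

  -- Columns are reduced from the last one down, so a reduction only ever adds original columns.
  private
    partiallyReduced : ℕ → Matrix
    partiallyReduced t i j = if does (t ≤? j) then reducedMatrix i j else M i j

    partiallyReduced-< : ∀ {t} i {j} → j < t → partiallyReduced t i j ≡ M i j
    partiallyReduced-< {t} i {j} j<t =
      cong (if_then reducedMatrix i j else M i j) (dec-false (t ≤? j) (<⇒≱ j<t))

    partiallyReduced-≥ : ∀ {t} i {j} → t ≤ j → partiallyReduced t i j ≡ reducedMatrix i j
    partiallyReduced-≥ {t} i {j} t≤j =
      cong (if_then reducedMatrix i j else M i j) (dec-true (t ≤? j) t≤j)

    reduce-column : ∀ n t → t < n → detℤ n (partiallyReduced t) ≡ detℤ n (partiallyReduced (suc t))
    reduce-column n t t<n =
      detℤ-add-combination n _ _ (combination (R t)) (earlier (R t)) t<n untouched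
        (λ i → trans (partiallyReduced-≥ i ≤-refl)
          (cong₂ ℤ._+_ (sym (partiallyReduced-< i (n<1+n t)))
            (combine-cong-earlier (combination (R t)) (earlier (R t))
              (λ k k<t → sym (partiallyReduced-< i (<-trans k<t (n<1+n t)))))))
      where
      untouched : ∀ i l → l ≢ t → partiallyReduced t i l ≡ partiallyReduced (suc t) i l
      untouched i l l≢t with <-cmp l t
      ... | tri< l<t _ _ = trans (partiallyReduced-< i l<t) (sym (partiallyReduced-< i (<-trans l<t (n<1+n t))))
      ... | tri≈ _ l≡t _ = contradiction l≡t l≢t
      ... | tri> _ _ t<l = trans (partiallyReduced-≥ i (<⇒≤ t<l)) (sym (partiallyReduced-≥ i t<l))

    reduce-columns-from : ∀ n s t → s + t ≡ n → detℤ n (partiallyReduced t) ≡ detℤ n M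
    reduce-columns-from n zero    t refl = detℤ-cong n λ i j j<t → partiallyReduced-< i j<t
    reduce-columns-from n (suc s) t s+t≡n =
      trans (reduce-column n t (subst (t <_) s+t≡n (s≤s (m≤n+m t s))))
            (reduce-columns-from n s (suc t) (trans (+-suc s t) s+t≡n))

  detℤ-reducedMatrix : ∀ n → detℤ n reducedMatrix ≡ detℤ n M
  detℤ-reducedMatrix n = trans (detℤ-cong n λ i j _ → sym (partiallyReduced-≥ i z≤n))
                               (reduce-columns-from n n 0 (+-identityʳ n))

  detℤ-reducible-IsUnit : ∀ n → IsUnit (detℤ n M)
  detℤ-reducible-IsUnit n = subst IsUnit (detℤ-reducedMatrix n)
    (detℤ-lowerTriangular n reducedMatrix (λ i j i<j → above-zero (R j) i i<j) (λ j → diagonal (R j)))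

coeff-+P : ∀ p q k → coeff (p +P q) k ≡ coeff p k ℤ.+ coeff q k
coeff-+P []      q       k       = sym (ℤP.+-identityˡ _)
coeff-+P (a ∷ p) []      k       = sym (ℤP.+-identityʳ _)
coeff-+P (a ∷ p) (b ∷ q) zero    = refl
coeff-+P (a ∷ p) (b ∷ q) (suc k) = coeff-+P p q k

coeff-map : ∀ {f : ℤ → ℤ} → f 0ℤ ≡ 0ℤ → ∀ p k → coeff (map f p) k ≡ f (coeff p k)
coeff-map f0≡0 []      k       = sym f0≡0
coeff-map f0≡0 (a ∷ p) zero    = refl
coeff-map f0≡0 (a ∷ p) (suc k) = coeff-map f0≡0 p k

coeff-signP : ∀ s p k → coeff (signP s p) k ≡ -1ℤ ℤ.^ s ℤ.* coeff p k
coeff-signP zero    p k = sym (ℤP.*-identityˡ _)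
coeff-signP (suc s) p k = begin
  coeff (negP (signP s p)) k              ≡⟨ coeff-map refl (signP s p) k ⟩
  ℤ.- coeff (signP s p) k                 ≡⟨ cong ℤ.-_ (coeff-signP s p k) ⟩
  ℤ.- (-1ℤ ℤ.^ s ℤ.* coeff p k)           ≡⟨ ℤP.-1*i≡-i _ ⟨
  -1ℤ ℤ.* (-1ℤ ℤ.^ s ℤ.* coeff p k)       ≡⟨ ℤP.*-assoc -1ℤ (-1ℤ ℤ.^ s) (coeff p k) ⟨
  -1ℤ ℤ.^ suc s ℤ.* coeff p k             ∎
  where open ≡-Reasoning

coeff-uPow-*P : ∀ e q t → coeff (uPow e *P q) (e + t) ≡ coeff q t
coeff-uPow-*P zero    q t = begin
  coeff (map (1ℤ ℤ.*_) q +P (0ℤ ∷ [])) t           ≡⟨ coeff-+P (map (1ℤ ℤ.*_) q) (0ℤ ∷ []) t ⟩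
  coeff (map (1ℤ ℤ.*_) q) t ℤ.+ coeff (0ℤ ∷ []) t  ≡⟨ cong₂ ℤ._+_ (coeff-map refl q t) (coeff-0 t) ⟩
  1ℤ ℤ.* coeff q t ℤ.+ 0ℤ                          ≡⟨ ℤP.+-identityʳ _ ⟩
  1ℤ ℤ.* coeff q t                                 ≡⟨ ℤP.*-identityˡ _ ⟩
  coeff q t                                        ∎
  where
  open ≡-Reasoning
  coeff-0 : ∀ t → coeff (0ℤ ∷ []) t ≡ 0ℤ
  coeff-0 zero    = refl
  coeff-0 (suc t) = refl
coeff-uPow-*P (suc e) q t = begin
  coeff (map (0ℤ ℤ.*_) q +P (0ℤ ∷ (uPow e *P q))) (suc (e + t))
    ≡⟨ coeff-+P (map (0ℤ ℤ.*_) q) _ (suc (e + t)) ⟩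
  coeff (map (0ℤ ℤ.*_) q) (suc (e + t)) ℤ.+ coeff (uPow e *P q) (e + t)
    ≡⟨ cong₂ ℤ._+_ (coeff-map refl q (suc (e + t))) (coeff-uPow-*P e q t) ⟩
  0ℤ ℤ.+ coeff q t
    ≡⟨ ℤP.+-identityˡ _ ⟩
  coeff q t ∎
  where open ≡-Reasoning

coeff-sumP : ∀ n (F : Fin n → Poly) k (h : ℕ → ℤ) → (∀ j → coeff (F j) k ≡ h (toℕ j)) →
             coeff (sumP n F) k ≡ sumℤ n h
coeff-sumP zero    F k h F≗h = refl
coeff-sumP (suc n) F k h F≗h = trans (coeff-+P (F Fin.zero) _ k)
  (cong₂ ℤ._+_ (F≗h Fin.zero) (coeff-sumP n (F ∘ Fin.suc) k (h ∘ suc) (F≗h ∘ Fin.suc)))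

toℕ-punchIn : ∀ {n} (j : Fin (suc n)) (c : Fin n) → toℕ (punchIn j c) ≡ punchInℕ (toℕ j) (toℕ c)
toℕ-punchIn Fin.zero    c           = refl
toℕ-punchIn (Fin.suc j) Fin.zero    = refl
toℕ-punchIn (Fin.suc j) (Fin.suc c) = cong suc (toℕ-punchIn j c)

sumℕ : ℕ → (ℕ → ℕ) → ℕ
sumℕ zero    h = 0
sumℕ (suc n) h = h 0 + sumℕ n (h ∘ suc)

sumℕ-punchIn : ∀ n {j} g → j < suc n → sumℕ (suc n) g ≡ g j + sumℕ n (g ∘ punchInℕ j)
sumℕ-punchIn n       {zero}  g _ = refl
sumℕ-punchIn (suc n) {suc j} g (s≤s j<1+n) =
  trans (cong (g 0 +_) (sumℕ-punchIn n (g ∘ suc) j<1+n))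
        (+-comm-middle (g 0) (g (suc j)) (sumℕ n (g ∘ suc ∘ punchInℕ j)))
  where
  +-comm-middle : ∀ a b d → a + (b + d) ≡ b + (a + d)
  +-comm-middle = solve-∀

MonomialEntries : ∀ n → (Fin n → Fin n → Poly) → (ℕ → ℕ → ℕ) → Set
MonomialEntries n M E = ∀ r c → M r c ≡ uPow (E (toℕ r) (toℕ c))

weight : ℕ → (ℕ → ℕ) → (ℕ → ℕ) → ℕ
weight n f g = sumℕ n f + sumℕ n g

tight : (ℕ → ℕ → ℕ) → (ℕ → ℕ) → (ℕ → ℕ) → Matrix
tight E f g r c = δ (E r c) (f r + g c)

module FirstRowTerm {n} (M : Fin (suc n) → Fin (suc n) → Poly) (E : ℕ → ℕ → ℕ) (f g : ℕ → ℕ)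
  (M≡u^E : MonomialEntries (suc n) M E) (E≤f+g : ∀ r c → E r c ≤ f r + g c) (j : Fin (suc n)) where

  minorM : Fin n → Fin n → Poly
  minorM r c = M (Fin.suc r) (punchIn j c)

  minorE : ℕ → ℕ → ℕ
  minorE r c = E (suc r) (punchInℕ (toℕ j) c)

  minorF minorG : ℕ → ℕ
  minorF = f ∘ suc
  minorG = g ∘ punchInℕ (toℕ j)

  minor-monomial : MonomialEntries n minorM minorE
  minor-monomial r c = trans (M≡u^E (Fin.suc r) (punchIn j c)) (cong (uPow ∘ E (suc (toℕ r))) (toℕ-punchIn j c))

  minor-bound : ∀ r c → minorE r c ≤ minorF r + minorG c
  minor-bound r c = E≤f+g (suc r) (punchInℕ (toℕ j) c)

  e : ℕ
  e = E 0 (toℕ j)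

  gap : ℕ
  gap = f 0 + g (toℕ j) ∸ e

  weight-split : weight (suc n) f g ≡ e + (gap + weight n minorF minorG)
  weight-split = begin
    (f 0 + F) + sumℕ (suc n) g          ≡⟨ cong ((f 0 + F) +_) (sumℕ-punchIn n g (toℕ<n j)) ⟩
    (f 0 + F) + (g (toℕ j) + G)         ≡⟨ interchange (f 0) F (g (toℕ j)) G ⟩
    (f 0 + g (toℕ j)) + (F + G)         ≡⟨ cong (_+ (F + G)) (m+[n∸m]≡n (E≤f+g 0 (toℕ j))) ⟨
    (e + gap) + (F + G)                 ≡⟨ +-assoc e gap (F + G) ⟩
    e + (gap + (F + G))                 ∎
    where
    open ≡-Reasoning
    F = sumℕ n minorF
    G = sumℕ n minorG
    interchange : ∀ a b c d → (a + b) + (c + d) ≡ (a + c) + (b + d)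
    interchange = solve-∀

  term : Poly
  term = signP (toℕ j) (M Fin.zero j *P det n minorM)

  coeff-term : ∀ t → coeff term (e + t) ≡ -1ℤ ℤ.^ toℕ j ℤ.* coeff (det n minorM) t
  coeff-term t = trans (coeff-signP (toℕ j) _ (e + t))
    (cong (-1ℤ ℤ.^ toℕ j ℤ.*_) (trans (cong (λ p → coeff (p *P det n minorM) (e + t)) (M≡u^E Fin.zero j))
                                       (coeff-uPow-*P e (det n minorM) t)))

det-monomial-high : ∀ n M E f g → MonomialEntries n M E → (∀ r c → E r c ≤ f r + g c) →
  ∀ m → coeff (det n M) (suc m + weight n f g) ≡ 0ℤ
det-monomial-high zero    M E f g M≡u^E E≤f+g m = refl
det-monomial-high (suc n) M E f g M≡u^E E≤f+g m =
  trans (coeff-sumP (suc n) (FirstRowTerm.term M E f g M≡u^E E≤f+g) (suc m + weight (suc n) f g) (λ _ → 0ℤ) term≡0)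
        (sumℤ-zero (suc n) (λ _ _ → refl))
  where
  term≡0 : ∀ j → coeff (FirstRowTerm.term M E f g M≡u^E E≤f+g j) (suc m + weight (suc n) f g) ≡ 0ℤ
  term≡0 j = begin
    coeff term (suc m + weight (suc n) f g)               ≡⟨ cong (coeff term ∘ (suc m +_)) weight-split ⟩
    coeff term (suc m + (e + (gap + W)))                  ≡⟨ cong (coeff term) (shift m e gap W) ⟩
    coeff term (e + (suc (m + gap) + W))                  ≡⟨ coeff-term (suc (m + gap) + W) ⟩
    -1ℤ ℤ.^ toℕ j ℤ.* coeff (det n minorM) (suc (m + gap) + W)
      ≡⟨ cong (-1ℤ ℤ.^ toℕ j ℤ.*_)
              (det-monomial-high n minorM minorE minorF minorG minor-monomial minor-bound (m + gap)) ⟩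
    -1ℤ ℤ.^ toℕ j ℤ.* 0ℤ                                  ≡⟨ ℤP.*-zeroʳ (-1ℤ ℤ.^ toℕ j) ⟩
    0ℤ                                                    ∎
    where
    open ≡-Reasoning
    open FirstRowTerm M E f g M≡u^E E≤f+g j
    W = weight n minorF minorG
    shift : ∀ m e d w → suc m + (e + (d + w)) ≡ e + (suc (m + d) + w)
    shift = solve-∀

det-monomial-top : ∀ n M E f g → MonomialEntries n M E → (∀ r c → E r c ≤ f r + g c) →
  coeff (det n M) (weight n f g) ≡ detℤ n (tight E f g)
det-monomial-top zero    M E f g M≡u^E E≤f+g = refl
det-monomial-top (suc n) M E f g M≡u^E E≤f+g =
  coeff-sumP (suc n) (FirstRowTerm.term M E f g M≡u^E E≤f+g) (weight (suc n) f g)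
    (λ j → -1ℤ ℤ.^ j ℤ.* (tight E f g 0 j ℤ.* detℤ n (minor (tight E f g) j))) top-term
  where
  top-term : ∀ j → coeff (FirstRowTerm.term M E f g M≡u^E E≤f+g j) (weight (suc n) f g) ≡
    -1ℤ ℤ.^ toℕ j ℤ.* (tight E f g 0 (toℕ j) ℤ.* detℤ n (minor (tight E f g) (toℕ j)))
  top-term j = begin
    coeff term (weight (suc n) f g)                  ≡⟨ cong (coeff term) weight-split ⟩
    coeff term (e + (gap + W))                       ≡⟨ coeff-term (gap + W) ⟩
    -1ℤ ℤ.^ toℕ j ℤ.* coeff (det n minorM) (gap + W) ≡⟨ cong (-1ℤ ℤ.^ toℕ j ℤ.*_) (by-gap gap refl) ⟩
    -1ℤ ℤ.^ toℕ j ℤ.* (tight E f g 0 (toℕ j) ℤ.* detℤ n (minor (tight E f g) (toℕ j))) ∎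
    where
    open ≡-Reasoning
    open FirstRowTerm M E f g M≡u^E E≤f+g j
    W = weight n minorF minorG
    T = detℤ n (minor (tight E f g) (toℕ j))
    -- a positive gap puts the index above the minor's degree bound
    by-gap : ∀ d → d ≡ gap → coeff (det n minorM) (d + W) ≡ tight E f g 0 (toℕ j) ℤ.* T
    by-gap zero    0≡gap = begin
      coeff (det n minorM) W  ≡⟨ det-monomial-top n minorM minorE minorF minorG minor-monomial minor-bound ⟩
      T                       ≡⟨ ℤP.*-identityˡ T ⟨
      1ℤ ℤ.* T                ≡⟨ cong (ℤ._* T) (δ-≡ tight-entry) ⟨
      tight E f g 0 (toℕ j) ℤ.* T ∎
      where
      tight-entry : e ≡ f 0 + g (toℕ j)
      tight-entry = trans (sym (+-identityʳ e)) (trans (cong (e +_) 0≡gap) (m+[n∸m]≡n (E≤f+g 0 (toℕ j))))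
    by-gap (suc d) 1+d≡gap = begin
      coeff (det n minorM) (suc d + W)  ≡⟨ det-monomial-high n minorM minorE minorF minorG minor-monomial minor-bound d ⟩
      0ℤ                                ≡⟨ ℤP.*-zeroˡ T ⟨
      0ℤ ℤ.* T                          ≡⟨ cong (ℤ._* T) (δ-≢ loose-entry) ⟨
      tight E f g 0 (toℕ j) ℤ.* T       ∎
      where
      loose-entry : e ≢ f 0 + g (toℕ j)
      loose-entry e≡ = 0≢1+n (trans (sym (n∸n≡0 e)) (trans (cong (_∸ e) e≡) (sym 1+d≡gap)))

carryFree : Matrix
carryFree = tight (λ r c → τ₂ (r + c)) τ₂ τ₂

carryFree-even-even : ∀ x y → carryFree (x * 2) (y * 2) ≡ carryFree x y
carryFree-even-even x y = cong₂ δ (τ₂-even+even x y) (cong₂ _+_ (τ₂-even x) (τ₂-even y))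

carryFree-even-odd : ∀ x y → carryFree (x * 2) (suc (y * 2)) ≡ carryFree x y
carryFree-even-odd x y =
  cong₂ δ (τ₂-even+odd x y) (trans (cong₂ _+_ (τ₂-even x) (τ₂-odd y)) (+-suc (τ₂ x) (τ₂ y)))

carryFree-odd-even : ∀ x y → carryFree (suc (x * 2)) (y * 2) ≡ carryFree x y
carryFree-odd-even x y = cong₂ δ (τ₂-odd+even x y) (cong₂ _+_ (τ₂-odd x) (τ₂-even y))

carryFree-odd-odd : ∀ x y → carryFree (suc (x * 2)) (suc (y * 2)) ≡ 0ℤ
carryFree-odd-odd x y = δ-≢ (<⇒≢ (τ₂-odd+odd-< x y (τ₂-subadditive x y)))

open ColumnReduction

reduce-carryFree-zero : ColumnReduction carryFree 0
reduce-carryFree-zero = record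
  { combination = [] ; earlier = [] ; above-zero = λ _ () ; diagonal = inj₁ refl }

reduce-carryFree-even : ∀ {m} → ColumnReduction carryFree m → ColumnReduction carryFree (m * 2)
reduce-carryFree-even {m} R = record
  { combination = L
  ; earlier     = map⁺ (All.map (*-monoˡ-< 2) (earlier R))
  ; above-zero  = zero-above
  ; diagonal    = subst IsUnit (sym (even-row m)) (diagonal R)
  }
  where
  L : Combination
  L = mapColumns (_* 2) (combination R)
  even-row : ∀ x → reduced carryFree L (m * 2) (x * 2) ≡ reduced carryFree (combination R) m x
  even-row x = cong₂ ℤ._+_ (carryFree-even-even x m)
    (trans (combine-mapColumns _ (combination R) _) (combine-cong (combination R) (carryFree-even-even x)))
  odd-row : ∀ x → reduced carryFree L (m * 2) (suc (x * 2)) ≡ reduced carryFree (combination R) m x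
  odd-row x = cong₂ ℤ._+_ (carryFree-odd-even x m)
    (trans (combine-mapColumns _ (combination R) _) (combine-cong (combination R) (carryFree-odd-even x)))
  zero-above : ∀ i → i < m * 2 → reduced carryFree L (m * 2) i ≡ 0ℤ
  zero-above i i<2m with halving i
  ... | even x = trans (even-row x) (above-zero R x (*-cancelʳ-< 2 x m i<2m))
  ... | odd x  = trans (odd-row x) (above-zero R x (*-cancelʳ-< 2 x m (<-trans (n<1+n _) i<2m)))

oddMinusEven-earlier : ∀ {m} L → All ((_< m) ∘ proj₂) L → All ((_< suc (m * 2)) ∘ proj₂) (oddMinusEven L)
oddMinusEven-earlier []      []          = []
oddMinusEven-earlier (_ ∷ L) (k<m ∷ k<ms) =
  s≤s (*-monoˡ-< 2 k<m) ∷ m<n⇒m<1+n (*-monoˡ-< 2 k<m) ∷ oddMinusEven-earlier L k<ms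

-- Column 2k+1 minus column 2k vanishes on even rows and is −T(x,k) on row 2x+1.
reduce-carryFree-odd : ∀ {m} → ColumnReduction carryFree m → ColumnReduction carryFree (suc (m * 2))
reduce-carryFree-odd {m} R = record
  { combination = L
  ; earlier     = n<1+n _ ∷ oddMinusEven-earlier (combination R) (earlier R)
  ; above-zero  = zero-above
  ; diagonal    = subst IsUnit (sym (odd-row m)) (IsUnit-* (inj₂ refl) (diagonal R))
  }
  where
  L : Combination
  L = (-1ℤ , m * 2) ∷ oddMinusEven (combination R)
  D : Matrix
  D r k = carryFree r (suc (k * 2)) ℤ.- carryFree r (k * 2)
  row : ∀ r x a → (∀ k → D r k ≡ a ℤ.* carryFree x k) →
        reduced carryFree L (suc (m * 2)) r ≡ a ℤ.* reduced carryFree (combination R) m x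
  row r x a D≗aM = trans (reduced-oddMinusEven carryFree (combination R) m r)
                         (reduced-scale carryFree D (combination R) m r x a D≗aM)
  even-row : ∀ x → reduced carryFree L (suc (m * 2)) (x * 2) ≡ 0ℤ
  even-row x = trans (row (x * 2) x 0ℤ λ k →
      trans (cong₂ ℤ._-_ (carryFree-even-odd x k) (carryFree-even-even x k)) (ℤP.+-inverseʳ (carryFree x k)))
    (ℤP.*-zeroˡ (reduced carryFree (combination R) m x))
  odd-row : ∀ x → reduced carryFree L (suc (m * 2)) (suc (x * 2)) ≡ -1ℤ ℤ.* reduced carryFree (combination R) m x
  odd-row x = row (suc (x * 2)) x -1ℤ λ k →
    trans (cong₂ ℤ._-_ (carryFree-odd-odd x k) (carryFree-odd-even x k))
          (trans (ℤP.+-identityˡ _) (sym (ℤP.-1*i≡-i (carryFree x k))))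
  zero-above : ∀ i → i < suc (m * 2) → reduced carryFree L (suc (m * 2)) i ≡ 0ℤ
  zero-above i i<2m+1 with halving i
  ... | even x = even-row x
  ... | odd x  = trans (odd-row x)
    (trans (cong (-1ℤ ℤ.*_) (above-zero R x (*-cancelʳ-< 2 x m (≤-pred i<2m+1)))) (ℤP.*-zeroʳ -1ℤ))

carryFree-reduction : ∀ j → ColumnReduction carryFree j
carryFree-reduction = binary-ind _ reduce-carryFree-zero (λ _ → reduce-carryFree-even) (λ _ → reduce-carryFree-odd)

sumℕ-τ₂ : ∀ n → sumℕ (suc n) τ₂ ≡ σ n
sumℕ-τ₂ zero    = refl
sumℕ-τ₂ (suc n) = trans (sumℕ-snoc (suc n) τ₂) (cong (_+ τ₂ (suc n)) (sumℕ-τ₂ n))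
  where
  sumℕ-snoc : ∀ n h → sumℕ (suc n) h ≡ sumℕ n h + h n
  sumℕ-snoc zero    h = +-identityʳ (h 0)
  sumℕ-snoc (suc n) h = trans (cong (h 0 +_) (sumℕ-snoc n (h ∘ suc))) (sym (+-assoc (h 0) _ _))

HasDegree-intro : ∀ p {d} → coeff p d ≢ 0ℤ → (∀ m → coeff p (suc m + d) ≡ 0ℤ) → HasDegree p d
HasDegree-intro p {d} top≢0 high≡0 = top≢0 , λ m d<m →
  subst (λ k → coeff p k ≡ 0ℤ) (trans (sym (+-suc (m ∸ suc d) d)) (m∸n+n≡m d<m)) (high≡0 (m ∸ suc d))

IsUnit⇒≢0 : ∀ {z} → IsUnit z → z ≢ 0ℤ
IsUnit⇒≢0 (inj₁ refl) ()
IsUnit⇒≢0 (inj₂ refl) ()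

proposition4 : (n : ℕ) → 1 ≤ n → HasDegree (det (suc n) (H1 n)) (2 * σ n)
proposition4 n _ =
  subst (HasDegree (det (suc n) (H1 n))) weight≡2σ (HasDegree-intro (det (suc n) (H1 n)) top≢0 high≡0)
  where
  exponent : ℕ → ℕ → ℕ
  exponent r c = τ₂ (r + c)
  monomial : MonomialEntries (suc n) (H1 n) exponent
  monomial _ _ = refl
  top≢0 : coeff (det (suc n) (H1 n)) (weight (suc n) τ₂ τ₂) ≢ 0ℤ
  top≢0 = IsUnit⇒≢0 (subst IsUnit
    (sym (det-monomial-top (suc n) (H1 n) exponent τ₂ τ₂ monomial τ₂-subadditive))
    (detℤ-reducible-IsUnit carryFree-reduction (suc n)))
  high≡0 : ∀ m → coeff (det (suc n) (H1 n)) (suc m + weight (suc n) τ₂ τ₂) ≡ 0ℤ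
  high≡0 = det-monomial-high (suc n) (H1 n) exponent τ₂ τ₂ monomial τ₂-subadditive
  weight≡2σ : weight (suc n) τ₂ τ₂ ≡ 2 * σ n
  weight≡2σ = trans (cong₂ _+_ (sumℕ-τ₂ n) (sumℕ-τ₂ n)) (cong (σ n +_) (sym (+-identityʳ (σ n))))
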